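{- Let $a,b\ge 2$ be integers, let $n$ be an integer, and let $r=a$, $s=b$ if $n$ is even and $r=b$, $s=a$ if $n$ is odd. Abbreviate $f_m=f_{(a,b,m)}$, $t_m=t_{(a,b,m)}$, $I_m=I_{(a,b,m)}$. (1) If $r$ is even and $n\ge 7$, then $f_n = \left( f_{n-2}^{s} I_{n-2} t_{n-2}^{s-1}\right)^{r/2} f_{n-2}$. (2) If $r$ and $s$ are both odd and $n\ge 8$, then with $X = f_{n-3}^{r} I_{n-3} t_{n-3}^{r-1}$, $$f_n = \left[ X^{(s+1)/2}\, t_{n-3}\, X^{(s-1)/2}\, f_{n-3}\right]^{(r-1)/2} X^{(s+1)/2}\, t_{n-3}.$$ (3) If $r$ is odd, $s$ is even and $n\ge 9$, then with $Y = f_{n-4}^{s} I_{n-4} t_{n-4}^{s-1}$, $B = Y^{(r+1)/2} t_{n-4} Y^{(r-1)/2} f_{n-4}$, $C = Y^{(r+1)/2} f_{n-4}$ and $D = Y^{(r+1)/2} t_{n-4}$, $$f_n = \left\{ B^{s/2}\, C\, B^{(s-2)/2}\, D\right\}^{(r-1)/2} B^{s/2}\, C.$$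
   Context: Words are over the alphabet $\{0,1\}$, with concatenation as the product; $w^k$ denotes the concatenation of $k$ copies of $w$ ($w^0$ is the empty word). For integers $a,b\ge 1$ the biperiodic Fibonacci words are defined by $f_{(a,b,0)}=0$, $f_{(a,b,1)}=0^{a-1}1$, and for $n\ge 2$: $f_{(a,b,n)} = f_{(a,b,n-1)}^{a}f_{(a,b,n-2)}$ if $n$ is even, and $f_{(a,b,n)} = f_{(a,b,n-1)}^{b}f_{(a,b,n-2)}$ if $n$ is odd. For a word $f_{(a,b,n)}$ with at least two letters, write $f_{(a,b,n)} = p\,xy$ with $x,y$ letters; then $t_{(a,b,n)} := p\,yx$. For $m\ge 5$ let $r_m = a$ if $m$ is even and $r_m=b$ if $m$ is odd. With $a,b\ge 2$, $f_{(a,b,m)}$ has suffix $w_m := f_{(a,b,m-1)}^{r_m-2}f_{(a,b,m-2)}$ and $t_{(a,b,m)}$ has prefix $w_m$. The word $I_{(a,b,m)}$ is defined as the word which begins with $f_{(a,b,m)}$ and ends with $t_{(a,b,m)}$, where these two occurrences overlap in exactly $w_m$; i.e. $I_{(a,b,m)} = u\,w_m\,v$ where $f_{(a,b,m)}=u\,w_m$ and $t_{(a,b,m)} = w_m\,v$. (Thus $f_{(a,b,n)}$ is expressed as a concatenation of words $f$, $t$ and overlapping concatenations $I$ of level $n-2$, $n-3$ or $n-4$.) -}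

module Defs where

open import Data.Nat using (ℕ; zero; suc; _∸_; _+_)
open import Data.Bool using (Bool; true; false; if_then_else_)
open import Data.List using (List; []; _∷_; _++_; reverse; drop; length; replicate)

data Letter : Set where
  𝟘 𝟙 : Letter

Word : Set
Word = List Letter

_^ʷ_ : Word → ℕ → Word
w ^ʷ zero  = []
w ^ʷ suc k = w ++ (w ^ʷ k)

isEven : ℕ → Bool
isEven zero = true
isEven (suc zero) = false
isEven (suc (suc n)) = isEven n

parSel : ℕ → ℕ → ℕ → ℕ
parSel a b m = if isEven m then a else b

fib : ℕ → ℕ → ℕ → Word
fib a b zero = 𝟘 ∷ []
fib a b (suc zero) = replicate (a ∸ 1) 𝟘 ++ (𝟙 ∷ [])
fib a b (suc (suc n)) = (fib a b (suc n) ^ʷ parSel a b (suc (suc n))) ++ fib a b n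

-- swap the last two letters (words with < 2 letters are left unchanged;
-- this case never arises for the words used here)
swapLast : Word → Word
swapLast w with reverse w
... | x ∷ y ∷ rest = reverse (y ∷ x ∷ rest)
... | _ = w

tw : ℕ → ℕ → ℕ → Word
tw a b n = swapLast (fib a b n)

ww : ℕ → ℕ → ℕ → Word
ww a b m = (fib a b (m ∸ 1) ^ʷ (parSel a b m ∸ 2)) ++ fib a b (m ∸ 2)

-- I_(a,b,m) = u w_m v  where f_m = u w_m and t_m = w_m v,
-- i.e. f_m followed by t_m with its prefix w_m removed.
Iw : ℕ → ℕ → ℕ → Word
Iw a b m = fib a b m ++ drop (length (ww a b m)) (tw a b m)

-- Since f_{k+1} f_k and f_k f_{k+1} differ only by a swap of their last two letters,
-- t_k = f_{k-1}^(r_k - 1) f_{k-2} f_{k-1}.  Hence A E = E t_k for A = f_k, E = f_{k-1},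
-- the overlap I_k is E A E, and A^p I_k t_k^(p-1) = (A^p E)².  So the words X and Y of
-- the statement, and the base of the power in (1), are squares of Fibonacci words:
-- f_{n-2}², f_{n-3}² and f_{n-1}².  Everything then follows from
-- f_n = (f_{n-2}^s f_{n-3})^r f_{n-2} by splitting odd powers as w^(2v+1) = (w²)^v w and
-- regrouping with the conjugation f_m t_{m-1} = f_{m-1} f_m.
module Submission where

open import Defs
open import Data.Nat using (ℕ; zero; suc; _≤_; _∸_; _+_; _*_; _/_; s≤s; z≤n)
open import Data.Nat.Properties using (+-comm; <⇒≤; ≤-trans; m≤m+n)
open import Data.Nat.DivMod using (m*n/n≡m)
open import Data.Nat.Divisibility using (_∣_; divides; ∣m∣n⇒∣m+n; ∣-refl)
open import Data.List using ([]; _∷_; _++_; reverse; drop; length; replicate)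
open import Data.List.Properties using (++-monoid; ++-assoc; ++-identityʳ; reverse-++; reverse-involutive)
open import Data.Product using (_×_; _,_; ∃-syntax)
open import Data.Bool using (true; false; not)
open import Data.Empty using (⊥-elim)
open import Function using (_∘_)
open import Relation.Nullary using (¬_)
open import Relation.Binary.PropositionalEquality
  using (_≡_; refl; sym; trans; cong; cong₂; subst₂; module ≡-Reasoning)
open import Tactic.MonoidSolver using (solve)
open ≡-Reasoning

private
  ++-Monoid = ++-monoid Letter

^ʷ-+ : ∀ (w : Word) m n → w ^ʷ (m + n) ≡ w ^ʷ m ++ w ^ʷ n
^ʷ-+ w zero    n = refl
^ʷ-+ w (suc m) n = trans (cong (w ++_) (^ʷ-+ w m n)) (sym (++-assoc w (w ^ʷ m) (w ^ʷ n)))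

^ʷ-* : ∀ (w : Word) m n → w ^ʷ (m * n) ≡ (w ^ʷ n) ^ʷ m
^ʷ-* w zero    n = refl
^ʷ-* w (suc m) n = trans (^ʷ-+ w n (m * n)) (cong (w ^ʷ n ++_) (^ʷ-* w m n))

^ʷ-comm : ∀ (w : Word) n → w ++ w ^ʷ n ≡ w ^ʷ n ++ w
^ʷ-comm w zero    = ++-identityʳ w
^ʷ-comm w (suc n) = trans (cong (w ++_) (^ʷ-comm w n)) (sym (++-assoc w (w ^ʷ n) w))

^ʷ-square : ∀ (w : Word) → w ^ʷ 2 ≡ w ++ w
^ʷ-square w = cong (w ++_) (++-identityʳ w)

^ʷ-pred : ∀ (w : Word) {p} → 1 ≤ p → w ^ʷ p ≡ w ++ w ^ʷ (p ∸ 1)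
^ʷ-pred w (s≤s z≤n) = refl

^ʷ-half : ∀ (w : Word) {r} → 2 ∣ r → w ^ʷ r ≡ (w ^ʷ 2) ^ʷ (r / 2)
^ʷ-half w (divides k refl) = trans (^ʷ-* w k 2) (cong ((w ^ʷ 2) ^ʷ_) (sym (m*n/n≡m k 2)))

^ʷ-odd : ∀ (w z : Word) k → w ^ʷ suc (k * 2) ++ z ≡ (w ^ʷ 2) ^ʷ k ++ w ++ z
^ʷ-odd w z k = begin
  (w ++ w ^ʷ (k * 2)) ++ z   ≡⟨ cong (_++ z) (^ʷ-comm w (k * 2)) ⟩
  (w ^ʷ (k * 2) ++ w) ++ z   ≡⟨ ++-assoc (w ^ʷ (k * 2)) w z ⟩
  w ^ʷ (k * 2) ++ w ++ z     ≡⟨ cong (_++ w ++ z) (^ʷ-* w k 2) ⟩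
  (w ^ʷ 2) ^ʷ k ++ w ++ z    ∎

^ʷ-conj : ∀ {u v w : Word} q → u ++ v ≡ v ++ w → u ^ʷ q ++ v ≡ v ++ w ^ʷ q
^ʷ-conj {v = v} zero    _     = sym (++-identityʳ v)
^ʷ-conj {u} {v} {w} (suc q) uv≡vw = begin
  (u ++ u ^ʷ q) ++ v   ≡⟨ ++-assoc u (u ^ʷ q) v ⟩
  u ++ (u ^ʷ q ++ v)   ≡⟨ cong (u ++_) (^ʷ-conj q uv≡vw) ⟩
  u ++ (v ++ w ^ʷ q)   ≡⟨ sym (++-assoc u v (w ^ʷ q)) ⟩
  (u ++ v) ++ w ^ʷ q   ≡⟨ cong (_++ w ^ʷ q) uv≡vw ⟩
  (v ++ w) ++ w ^ʷ q   ≡⟨ ++-assoc v w (w ^ʷ q) ⟩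
  v ++ w ++ w ^ʷ q     ∎

conj-square-overlap : ∀ {A E t I : Word} {p} → A ++ E ≡ E ++ t → I ≡ E ++ A ++ E → 1 ≤ p →
  A ^ʷ p ++ I ++ t ^ʷ (p ∸ 1) ≡ (A ^ʷ p ++ E) ^ʷ 2
conj-square-overlap {A} {E} {t} {I} {suc q} AE≡Et refl (s≤s z≤n) = begin
  A ^ʷ suc q ++ (E ++ A ++ E) ++ t ^ʷ q   ≡⟨ solve ++-Monoid ⟩
  A ^ʷ suc q ++ E ++ A ++ (E ++ t ^ʷ q)   ≡⟨ cong (λ w → A ^ʷ suc q ++ E ++ A ++ w) (sym (^ʷ-conj q AE≡Et)) ⟩
  A ^ʷ suc q ++ E ++ A ++ (A ^ʷ q ++ E)   ≡⟨ solve ++-Monoid ⟩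
  (A ^ʷ suc q ++ E) ++ (A ^ʷ suc q ++ E)  ≡⟨ sym (^ʷ-square (A ^ʷ suc q ++ E)) ⟩
  (A ^ʷ suc q ++ E) ^ʷ 2                  ∎

conj-shift : ∀ {A E t : Word} p → A ++ E ≡ E ++ t → (A ^ʷ p ++ E) ++ t ≡ A ++ (A ^ʷ p ++ E)
conj-shift {A} {E} {t} p AE≡Et = begin
  (A ^ʷ p ++ E) ++ t   ≡⟨ ++-assoc (A ^ʷ p) E t ⟩
  A ^ʷ p ++ (E ++ t)   ≡⟨ cong (A ^ʷ p ++_) (sym AE≡Et) ⟩
  A ^ʷ p ++ (A ++ E)   ≡⟨ sym (++-assoc (A ^ʷ p) A E) ⟩
  (A ^ʷ p ++ A) ++ E   ≡⟨ cong (_++ E) (sym (^ʷ-comm A p)) ⟩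
  (A ++ A ^ʷ p) ++ E   ≡⟨ ++-assoc A (A ^ʷ p) E ⟩
  A ++ (A ^ʷ p ++ E)   ∎

conj-end : ∀ {Z W t : Word} p → Z ++ t ≡ W ++ Z → (Z ^ʷ p ++ W) ++ Z ≡ Z ^ʷ suc p ++ t
conj-end {Z} {W} {t} p Zt≡WZ = begin
  (Z ^ʷ p ++ W) ++ Z   ≡⟨ ++-assoc (Z ^ʷ p) W Z ⟩
  Z ^ʷ p ++ (W ++ Z)   ≡⟨ cong (Z ^ʷ p ++_) (sym Zt≡WZ) ⟩
  Z ^ʷ p ++ (Z ++ t)   ≡⟨ sym (++-assoc (Z ^ʷ p) Z t) ⟩
  (Z ^ʷ p ++ Z) ++ t   ≡⟨ cong (_++ t) (sym (^ʷ-comm Z p)) ⟩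
  Z ^ʷ suc p ++ t      ∎

conj-square : ∀ {Z W t : Word} p → Z ++ t ≡ W ++ Z →
  (Z ^ʷ suc p ++ W) ^ʷ 2 ≡ Z ^ʷ suc (suc p) ++ t ++ Z ^ʷ p ++ W
conj-square {Z} {W} {t} p Zt≡WZ = begin
  (Z ^ʷ suc p ++ W) ^ʷ 2                     ≡⟨ ^ʷ-square (Z ^ʷ suc p ++ W) ⟩
  (Z ^ʷ suc p ++ W) ++ (Z ++ Z ^ʷ p) ++ W    ≡⟨ solve ++-Monoid ⟩
  ((Z ^ʷ suc p ++ W) ++ Z) ++ Z ^ʷ p ++ W    ≡⟨ cong (_++ Z ^ʷ p ++ W) (conj-end {Z} {W} {t} (suc p) Zt≡WZ) ⟩
  (Z ^ʷ suc (suc p) ++ t) ++ Z ^ʷ p ++ W     ≡⟨ ++-assoc (Z ^ʷ suc (suc p)) t _ ⟩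
  Z ^ʷ suc (suc p) ++ t ++ Z ^ʷ p ++ W       ∎

¬2∣⇒odd : ∀ {m} → ¬ 2 ∣ m → ∃[ k ] m ≡ suc (k * 2)
¬2∣⇒odd {zero}        ¬2∣m = ⊥-elim (¬2∣m (divides 0 refl))
¬2∣⇒odd {suc zero}    ¬2∣m = 0 , refl
¬2∣⇒odd {suc (suc m)} ¬2∣m with ¬2∣⇒odd (¬2∣m ∘ ∣m∣n⇒∣m+n ∣-refl)
... | k , refl = suc k , refl

[1+k*2+1]/2≡1+k : ∀ k → (suc (k * 2) + 1) / 2 ≡ suc k
[1+k*2+1]/2≡1+k k = trans (cong (_/ 2) (+-comm (suc (k * 2)) 1)) (m*n/n≡m (suc k) 2)

odd-odd-factorisation : ∀ {Z W t X : Word} {r s} → Z ++ t ≡ W ++ Z → X ≡ Z ^ʷ 2 → ¬ 2 ∣ r → ¬ 2 ∣ s →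
  (Z ^ʷ s ++ W) ^ʷ r ++ Z
    ≡ (X ^ʷ ((s + 1) / 2) ++ t ++ X ^ʷ ((s ∸ 1) / 2) ++ W) ^ʷ ((r ∸ 1) / 2) ++ X ^ʷ ((s + 1) / 2) ++ t
odd-odd-factorisation {Z} {W} {t} Zt≡WZ refl ¬2∣r ¬2∣s with ¬2∣⇒odd ¬2∣r | ¬2∣⇒odd ¬2∣s
... | v , refl | u , refl = begin
  V ^ʷ suc (v * 2) ++ Z
    ≡⟨ ^ʷ-odd V Z v ⟩
  (V ^ʷ 2) ^ʷ v ++ V ++ Z
    ≡⟨ cong₂ (λ x y → x ^ʷ v ++ y) (conj-square {Z} {W} (u * 2) Zt≡WZ) (conj-end {Z} {W} (suc (u * 2)) Zt≡WZ) ⟩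
  Φ (Z ^ʷ (suc u * 2)) (Z ^ʷ (u * 2)) v
    ≡⟨ cong₂ (λ x y → Φ x y v) (^ʷ-* Z (suc u) 2) (^ʷ-* Z u 2) ⟩
  Φ ((Z ^ʷ 2) ^ʷ suc u) ((Z ^ʷ 2) ^ʷ u) v
    ≡⟨ cong₂ (λ i j → Φ ((Z ^ʷ 2) ^ʷ i) ((Z ^ʷ 2) ^ʷ j) v) (sym ([1+k*2+1]/2≡1+k u)) (sym (m*n/n≡m u 2)) ⟩
  Φ ((Z ^ʷ 2) ^ʷ ((suc (u * 2) + 1) / 2)) ((Z ^ʷ 2) ^ʷ (u * 2 / 2)) v
    ≡⟨ cong (Φ _ _) (sym (m*n/n≡m v 2)) ⟩
  Φ ((Z ^ʷ 2) ^ʷ ((suc (u * 2) + 1) / 2)) ((Z ^ʷ 2) ^ʷ (u * 2 / 2)) (v * 2 / 2) ∎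
  where
  V = Z ^ʷ suc (u * 2) ++ W
  Φ : Word → Word → ℕ → Word
  Φ x y k = (x ++ t ++ y ++ W) ^ʷ k ++ x ++ t

square-regroup : ∀ (A Z : Word) m →
  (A ^ʷ suc (suc m) ++ Z) ^ʷ 2 ≡ A ^ʷ suc (suc m) ++ (Z ++ A) ++ A ^ʷ m ++ (A ++ Z)
square-regroup A Z m = begin
  V ^ʷ 2                                                ≡⟨ ^ʷ-square V ⟩
  V ++ (A ++ A ++ A ^ʷ m) ++ Z                          ≡⟨ cong (λ x → V ++ (A ++ x) ++ Z) (^ʷ-comm A m) ⟩
  V ++ (A ++ A ^ʷ m ++ A) ++ Z                          ≡⟨ solve ++-Monoid ⟩
  A ^ʷ suc (suc m) ++ (Z ++ A) ++ A ^ʷ m ++ (A ++ Z)    ∎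
  where
  V = A ^ʷ suc (suc m) ++ Z

odd-even-factorisation : ∀ {Z W t Y : Word} {r s} → Z ++ t ≡ W ++ Z → Y ≡ Z ^ʷ 2 →
  ¬ 2 ∣ r → 2 ∣ s → 2 ≤ s →
  let A = Z ^ʷ r ++ W
      B = Y ^ʷ ((r + 1) / 2) ++ t ++ Y ^ʷ ((r ∸ 1) / 2) ++ W
      C = Y ^ʷ ((r + 1) / 2) ++ W
      D = Y ^ʷ ((r + 1) / 2) ++ t
  in (A ^ʷ s ++ Z) ^ʷ r ++ A ≡ (B ^ʷ (s / 2) ++ C ++ B ^ʷ ((s ∸ 2) / 2) ++ D) ^ʷ ((r ∸ 1) / 2) ++ B ^ʷ (s / 2) ++ C
odd-even-factorisation _ _ _ (divides zero refl) ()
odd-even-factorisation {Z} {W} {t} Zt≡WZ refl ¬2∣r (divides (suc u) refl) _ with ¬2∣⇒odd ¬2∣r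
... | v , refl = begin
  V ^ʷ suc (v * 2) ++ A
    ≡⟨ ^ʷ-odd V A v ⟩
  (V ^ʷ 2) ^ʷ v ++ V ++ A
    ≡⟨ cong₂ (λ x y → x ^ʷ v ++ y) (square-regroup A Z (u * 2)) (++-assoc (A ^ʷ (suc u * 2)) Z A) ⟩
  Ψ (A ^ʷ (suc u * 2)) (A ^ʷ (u * 2)) (Z ++ A) (A ++ Z)
    ≡⟨ cong₂ (λ x y → Ψ x y (Z ++ A) (A ++ Z)) (^ʷ-* A (suc u) 2) (^ʷ-* A u 2) ⟩
  Ψ ((A ^ʷ 2) ^ʷ suc u) ((A ^ʷ 2) ^ʷ u) (Z ++ A) (A ++ Z)
    ≡⟨ cong₂ (λ x y → Ψ (x ^ʷ suc u) (x ^ʷ u) y (A ++ Z)) A²≡B ZA≡C ⟩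
  Ψ (B ^ʷ suc u) (B ^ʷ u) C (A ++ Z)
    ≡⟨ cong (Ψ (B ^ʷ suc u) (B ^ʷ u) C) AZ≡D ⟩
  shape (suc v) v (suc u) u
    ≡⟨ cong₂ (λ i j → shape i j (suc u) u) (sym ([1+k*2+1]/2≡1+k v)) (sym (m*n/n≡m v 2)) ⟩
  shape ((suc (v * 2) + 1) / 2) (v * 2 / 2) (suc u) u
    ≡⟨ cong₂ (shape ((suc (v * 2) + 1) / 2) (v * 2 / 2)) (sym (m*n/n≡m (suc u) 2)) (sym (m*n/n≡m u 2)) ⟩
  shape ((suc (v * 2) + 1) / 2) (v * 2 / 2) (suc u * 2 / 2) (u * 2 / 2) ∎
  where
  A = Z ^ʷ suc (v * 2) ++ W
  V = A ^ʷ (suc u * 2) ++ Z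
  B = (Z ^ʷ 2) ^ʷ suc v ++ t ++ (Z ^ʷ 2) ^ʷ v ++ W
  C = (Z ^ʷ 2) ^ʷ suc v ++ W
  D = (Z ^ʷ 2) ^ʷ suc v ++ t
  Ψ : Word → Word → Word → Word → Word
  Ψ x y c d = (x ++ c ++ y ++ d) ^ʷ v ++ x ++ c
  shape : ℕ → ℕ → ℕ → ℕ → Word
  shape i j k l = (Bᵢⱼ ^ʷ k ++ Cᵢ ++ Bᵢⱼ ^ʷ l ++ Dᵢ) ^ʷ j ++ Bᵢⱼ ^ʷ k ++ Cᵢ
    where
    Bᵢⱼ = (Z ^ʷ 2) ^ʷ i ++ t ++ (Z ^ʷ 2) ^ʷ j ++ W
    Cᵢ = (Z ^ʷ 2) ^ʷ i ++ W
    Dᵢ = (Z ^ʷ 2) ^ʷ i ++ t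
  A²≡B : A ^ʷ 2 ≡ B
  A²≡B = trans (conj-square {Z} {W} (v * 2) Zt≡WZ)
               (cong₂ (λ x y → x ++ t ++ y ++ W) (^ʷ-* Z (suc v) 2) (^ʷ-* Z v 2))
  ZA≡C : Z ++ A ≡ C
  ZA≡C = trans (sym (++-assoc Z (Z ^ʷ suc (v * 2)) W)) (cong (_++ W) (^ʷ-* Z (suc v) 2))
  AZ≡D : A ++ Z ≡ D
  AZ≡D = trans (conj-end {Z} {W} (suc (v * 2)) Zt≡WZ) (cong (_++ t) (^ʷ-* Z (suc v) 2))

data _⇄_ : Word → Word → Set where
  swap : ∀ c x y → (c ++ x ∷ y ∷ []) ⇄ (c ++ y ∷ x ∷ [])

⇄-sym : ∀ {u v} → u ⇄ v → v ⇄ u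
⇄-sym (swap c x y) = swap c y x

⇄-++ˡ : ∀ w {u v} → u ⇄ v → (w ++ u) ⇄ (w ++ v)
⇄-++ˡ w (swap c x y) = subst₂ _⇄_ (++-assoc w c _) (++-assoc w c _) (swap (w ++ c) x y)

swapLast-⇄ : ∀ {u v} → u ⇄ v → swapLast u ≡ v
swapLast-⇄ (swap c x y) rewrite reverse-++ c (x ∷ y ∷ []) =
  trans (reverse-++ (x ∷ y ∷ []) (reverse c)) (cong (_++ y ∷ x ∷ []) (reverse-involutive c))

⇄-power-step : ∀ {u v : Word} p → (v ++ u) ⇄ (u ++ v) → ((v ^ʷ p ++ u) ++ v) ⇄ (v ++ (v ^ʷ p ++ u))
⇄-power-step {u} {v} p vu⇄uv = subst₂ _⇄_ (sym (++-assoc (v ^ʷ p) u v)) assoc-comm (⇄-++ˡ (v ^ʷ p) (⇄-sym vu⇄uv))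
  where
  assoc-comm : v ^ʷ p ++ (v ++ u) ≡ v ++ (v ^ʷ p ++ u)
  assoc-comm = begin
    v ^ʷ p ++ (v ++ u)   ≡⟨ sym (++-assoc (v ^ʷ p) v u) ⟩
    (v ^ʷ p ++ v) ++ u   ≡⟨ cong (_++ u) (sym (^ʷ-comm v p)) ⟩
    (v ++ v ^ʷ p) ++ u   ≡⟨ ++-assoc v (v ^ʷ p) u ⟩
    v ++ (v ^ʷ p ++ u)   ∎

swapLast-power : ∀ {u v : Word} {p} → 1 ≤ p → (v ++ u) ⇄ (u ++ v) → swapLast (v ^ʷ p ++ u) ≡ v ^ʷ (p ∸ 1) ++ u ++ v
swapLast-power {u} {v} {suc q} (s≤s z≤n) vu⇄uv = swapLast-⇄ (subst₂ _⇄_ regroup refl (⇄-++ˡ (v ^ʷ q) vu⇄uv))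
  where
  regroup : v ^ʷ q ++ (v ++ u) ≡ v ^ʷ suc q ++ u
  regroup = begin
    v ^ʷ q ++ (v ++ u)   ≡⟨ sym (++-assoc (v ^ʷ q) v u) ⟩
    (v ^ʷ q ++ v) ++ u   ≡⟨ cong (_++ u) (sym (^ʷ-comm v q)) ⟩
    v ^ʷ suc q ++ u      ∎

power-conj : ∀ {u v : Word} {p} → 1 ≤ p → (v ^ʷ p ++ u) ++ v ≡ v ++ (v ^ʷ (p ∸ 1) ++ u ++ v)
power-conj {u} {v} {suc q} (s≤s z≤n) = solve ++-Monoid

drop-length-++ : ∀ (u v : Word) → drop (length u) (u ++ v) ≡ v
drop-length-++ []      v = refl
drop-length-++ (x ∷ u) v = drop-length-++ u v

overlap-sandwich : ∀ {F G H : Word} {p} → 2 ≤ p → F ≡ G ++ H →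
  (F ^ʷ p ++ G) ++ drop (length (F ^ʷ (p ∸ 2) ++ G)) (F ^ʷ (p ∸ 1) ++ G ++ F) ≡ F ++ (F ^ʷ p ++ G) ++ F
overlap-sandwich {F} {G} {H} {suc (suc q)} (s≤s (s≤s z≤n)) F≡GH = begin
  (F ^ʷ p ++ G) ++ drop (length (F ^ʷ q ++ G)) (F ^ʷ suc q ++ G ++ F)
    ≡⟨ cong (λ w → (F ^ʷ p ++ G) ++ drop (length (F ^ʷ q ++ G)) w) split ⟩
  (F ^ʷ p ++ G) ++ drop (length (F ^ʷ q ++ G)) ((F ^ʷ q ++ G) ++ H ++ G ++ F)
    ≡⟨ cong ((F ^ʷ p ++ G) ++_) (drop-length-++ (F ^ʷ q ++ G) _) ⟩
  (F ^ʷ p ++ G) ++ H ++ G ++ F   ≡⟨ solve ++-Monoid ⟩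
  F ^ʷ p ++ (G ++ H) ++ G ++ F   ≡⟨ cong (λ w → F ^ʷ p ++ w ++ G ++ F) (sym F≡GH) ⟩
  F ^ʷ p ++ F ++ G ++ F          ≡⟨ sym (++-assoc (F ^ʷ p) F (G ++ F)) ⟩
  (F ^ʷ p ++ F) ++ G ++ F        ≡⟨ cong (_++ G ++ F) (sym (^ʷ-comm F p)) ⟩
  (F ++ F ^ʷ p) ++ G ++ F        ≡⟨ solve ++-Monoid ⟩
  F ++ (F ^ʷ p ++ G) ++ F        ∎
  where
  p = suc (suc q)
  split : F ^ʷ suc q ++ G ++ F ≡ (F ^ʷ q ++ G) ++ H ++ G ++ F
  split = begin
    F ^ʷ suc q ++ G ++ F           ≡⟨ cong (_++ G ++ F) (^ʷ-comm F q) ⟩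
    (F ^ʷ q ++ F) ++ G ++ F        ≡⟨ cong (λ w → (F ^ʷ q ++ w) ++ G ++ F) F≡GH ⟩
    (F ^ʷ q ++ G ++ H) ++ G ++ F   ≡⟨ solve ++-Monoid ⟩
    (F ^ʷ q ++ G) ++ H ++ G ++ F   ∎

replicate-++-∷ : ∀ m (x : Letter) l → replicate m x ++ x ∷ l ≡ x ∷ replicate m x ++ l
replicate-++-∷ zero    x l = refl
replicate-++-∷ (suc m) x l = cong (x ∷_) (replicate-++-∷ m x l)

fib-⇄ : ∀ a b j → (fib a b (suc j) ++ fib a b j) ⇄ (fib a b j ++ fib a b (suc j))
fib-⇄ a b zero    = subst₂ _⇄_ (sym (++-assoc (replicate (a ∸ 1) 𝟘) _ _)) (replicate-++-∷ (a ∸ 1) 𝟘 _)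
                           (swap (replicate (a ∸ 1) 𝟘) 𝟙 𝟘)
fib-⇄ a b (suc j) = ⇄-power-step (parSel a b (2 + j)) (fib-⇄ a b j)

isEven-suc : ∀ m → isEven (suc m) ≡ not (isEven m)
isEven-suc zero          = refl
isEven-suc (suc zero)    = refl
isEven-suc (suc (suc m)) = isEven-suc m

parSel-suc : ∀ a b m → parSel a b (suc m) ≡ parSel b a m
parSel-suc a b m rewrite isEven-suc m with isEven m
... | true  = refl
... | false = refl

parSel-≥2 : ∀ {a b} → 2 ≤ a → 2 ≤ b → ∀ m → 2 ≤ parSel a b m
parSel-≥2 2≤a 2≤b m with isEven m
... | true  = 2≤a
... | false = 2≤b

fib-unfold-swap : ∀ a b m → fib a b (2 + m) ≡ fib a b (1 + m) ^ʷ parSel b a (1 + m) ++ fib a b m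
fib-unfold-swap a b m = cong (λ e → fib a b (1 + m) ^ʷ e ++ fib a b m) (parSel-suc a b (1 + m))

fib-unfold² : ∀ a b m →
  fib a b (3 + m) ≡ (fib a b (1 + m) ^ʷ parSel b a (3 + m) ++ fib a b m) ^ʷ parSel a b (3 + m) ++ fib a b (1 + m)
fib-unfold² a b m = cong (λ w → w ^ʷ parSel a b (3 + m) ++ fib a b (1 + m)) (fib-unfold-swap a b m)

module _ {a b : ℕ} (2≤a : 2 ≤ a) (2≤b : 2 ≤ b) where

  private
    f t I : ℕ → Word
    f = fib a b
    t = tw a b
    I = Iw a b
    r s : ℕ → ℕ
    r = parSel a b
    s = parSel b a

    1≤r : ∀ m → 1 ≤ r m
    1≤r m = <⇒≤ (parSel-≥2 2≤a 2≤b m)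

    1≤s : ∀ m → 1 ≤ s m
    1≤s m = <⇒≤ (parSel-≥2 2≤b 2≤a m)

  tw-unfold : ∀ j → t (2 + j) ≡ f (1 + j) ^ʷ (r (2 + j) ∸ 1) ++ f j ++ f (1 + j)
  tw-unfold j = swapLast-power (1≤r (2 + j)) (fib-⇄ a b j)

  fib-conj : ∀ j → f (2 + j) ++ f (1 + j) ≡ f (1 + j) ++ t (2 + j)
  fib-conj j = trans (power-conj (1≤r (2 + j))) (cong (f (1 + j) ++_) (sym (tw-unfold j)))

  fib-shift : ∀ j → f (3 + j) ++ t (2 + j) ≡ f (2 + j) ++ f (3 + j)
  fib-shift j = conj-shift (r (3 + j)) (fib-conj j)

  Iw-sandwich : ∀ j → I (3 + j) ≡ f (2 + j) ++ f (3 + j) ++ f (2 + j)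
  Iw-sandwich j = trans (cong (λ w → f (3 + j) ++ drop (length (ww a b (3 + j))) w) (tw-unfold (1 + j)))
                 (overlap-sandwich (parSel-≥2 2≤a 2≤b (3 + j)) head)
    where
    head : f (2 + j) ≡ f (1 + j) ++ (f (1 + j) ^ʷ (r (2 + j) ∸ 1) ++ f j)
    head = trans (cong (_++ f j) (^ʷ-pred (f (1 + j)) (1≤r (2 + j)))) (++-assoc (f (1 + j)) _ (f j))

  fib-square : ∀ j {p} → 1 ≤ p → f (3 + j) ^ʷ p ++ I (3 + j) ++ t (3 + j) ^ʷ (p ∸ 1) ≡ (f (3 + j) ^ʷ p ++ f (2 + j)) ^ʷ 2
  fib-square j = conj-square-overlap (fib-conj (1 + j)) (Iw-sandwich j)

  fib-factorisation-even : ∀ {n} → 5 ≤ n → 2 ∣ r n →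
    f n ≡ (f (n ∸ 2) ^ʷ s n ++ I (n ∸ 2) ++ t (n ∸ 2) ^ʷ (s n ∸ 1)) ^ʷ (r n / 2) ++ f (n ∸ 2)
  fib-factorisation-even {n@(suc (suc (suc (suc (suc j)))))} (s≤s (s≤s (s≤s (s≤s (s≤s z≤n))))) 2∣r = begin
    f n                                    ≡⟨ fib-unfold² a b (2 + j) ⟩
    P ^ʷ r n ++ f (3 + j)                  ≡⟨ cong (_++ f (3 + j)) (^ʷ-half P 2∣r) ⟩
    (P ^ʷ 2) ^ʷ (r n / 2) ++ f (3 + j)     ≡⟨ cong (λ x → x ^ʷ (r n / 2) ++ f (3 + j)) (sym (fib-square j (1≤s n))) ⟩
    (f (3 + j) ^ʷ s n ++ I (3 + j) ++ t (3 + j) ^ʷ (s n ∸ 1)) ^ʷ (r n / 2) ++ f (3 + j) ∎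
    where
    P = f (3 + j) ^ʷ s n ++ f (2 + j)

  fib-factorisation-odd-odd : ∀ {n} → 6 ≤ n → ¬ 2 ∣ r n → ¬ 2 ∣ s n →
    let X = f (n ∸ 3) ^ʷ r n ++ I (n ∸ 3) ++ t (n ∸ 3) ^ʷ (r n ∸ 1) in
    f n ≡ (X ^ʷ ((s n + 1) / 2) ++ t (n ∸ 3) ++ X ^ʷ ((s n ∸ 1) / 2) ++ f (n ∸ 3)) ^ʷ ((r n ∸ 1) / 2)
            ++ X ^ʷ ((s n + 1) / 2) ++ t (n ∸ 3)
  fib-factorisation-odd-odd {n@(suc (suc (suc (suc (suc (suc j))))))} (s≤s (s≤s (s≤s (s≤s (s≤s (s≤s z≤n)))))) ¬2∣r ¬2∣s =
    trans (fib-unfold² a b (3 + j))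
          (odd-odd-factorisation (fib-shift (1 + j)) (fib-square j (1≤r n)) ¬2∣r ¬2∣s)

  fib-factorisation-odd-even : ∀ {n} → 7 ≤ n → ¬ 2 ∣ r n → 2 ∣ s n →
    let Y = f (n ∸ 4) ^ʷ s n ++ I (n ∸ 4) ++ t (n ∸ 4) ^ʷ (s n ∸ 1)
        B = Y ^ʷ ((r n + 1) / 2) ++ t (n ∸ 4) ++ Y ^ʷ ((r n ∸ 1) / 2) ++ f (n ∸ 4)
        C = Y ^ʷ ((r n + 1) / 2) ++ f (n ∸ 4)
        D = Y ^ʷ ((r n + 1) / 2) ++ t (n ∸ 4)
    in f n ≡ (B ^ʷ (s n / 2) ++ C ++ B ^ʷ ((s n ∸ 2) / 2) ++ D) ^ʷ ((r n ∸ 1) / 2) ++ B ^ʷ (s n / 2) ++ C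
  fib-factorisation-odd-even {n@(suc (suc (suc (suc (suc (suc (suc j)))))))} (s≤s (s≤s (s≤s (s≤s (s≤s (s≤s (s≤s z≤n))))))) ¬2∣r 2∣s =
    trans (fib-unfold² a b (4 + j))
          (odd-even-factorisation (fib-shift (1 + j)) Y≡Z² ¬2∣r 2∣s (parSel-≥2 2≤b 2≤a n))
    where
    Y≡Z² : f (3 + j) ^ʷ s n ++ I (3 + j) ++ t (3 + j) ^ʷ (s n ∸ 1) ≡ f (4 + j) ^ʷ 2
    Y≡Z² = trans (fib-square j (1≤s n)) (cong (_^ʷ 2) (sym (fib-unfold-swap a b (2 + j))))

mainTheorem8 : (a b n : ℕ) → 2 ≤ a → 2 ≤ b →
  let r = parSel a b n
      s = parSel b a n
      f = fib a b
      t = tw a b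
      I = Iw a b
      X = (f (n ∸ 3) ^ʷ r) ++ I (n ∸ 3) ++ (t (n ∸ 3) ^ʷ (r ∸ 1))
      Y = (f (n ∸ 4) ^ʷ s) ++ I (n ∸ 4) ++ (t (n ∸ 4) ^ʷ (s ∸ 1))
      B = (Y ^ʷ ((r + 1) / 2)) ++ t (n ∸ 4) ++ (Y ^ʷ ((r ∸ 1) / 2)) ++ f (n ∸ 4)
      C = (Y ^ʷ ((r + 1) / 2)) ++ f (n ∸ 4)
      D = (Y ^ʷ ((r + 1) / 2)) ++ t (n ∸ 4)
  in ((2 ∣ r → 7 ≤ n →
        f n ≡ ((((f (n ∸ 2) ^ʷ s) ++ I (n ∸ 2) ++ (t (n ∸ 2) ^ʷ (s ∸ 1))) ^ʷ (r / 2))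
                 ++ f (n ∸ 2)))
    × (¬ (2 ∣ r) → ¬ (2 ∣ s) → 8 ≤ n →
        f n ≡ (((X ^ʷ ((s + 1) / 2)) ++ t (n ∸ 3) ++ (X ^ʷ ((s ∸ 1) / 2)) ++ f (n ∸ 3))
                 ^ʷ ((r ∸ 1) / 2))
               ++ (X ^ʷ ((s + 1) / 2)) ++ t (n ∸ 3))
    × (¬ (2 ∣ r) → 2 ∣ s → 9 ≤ n →
        f n ≡ ((B ^ʷ (s / 2)) ++ C ++ (B ^ʷ ((s ∸ 2) / 2)) ++ D) ^ʷ ((r ∸ 1) / 2)
               ++ (B ^ʷ (s / 2)) ++ C))
mainTheorem8 a b n 2≤a 2≤b =
    (λ 2∣r 7≤n → fib-factorisation-even 2≤a 2≤b (≤-trans (m≤m+n 5 2) 7≤n) 2∣r)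
  , (λ ¬2∣r ¬2∣s 8≤n → fib-factorisation-odd-odd 2≤a 2≤b (≤-trans (m≤m+n 6 2) 8≤n) ¬2∣r ¬2∣s)
  , (λ ¬2∣r 2∣s 9≤n → fib-factorisation-odd-even 2≤a 2≤b (≤-trans (m≤m+n 7 2) 9≤n) ¬2∣r 2∣s)
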